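{- Let $N \in \mathbb{N}$ and assume that there is a divisor $d \mid N$ such that $|\mathcal{L}_{\lambda}(d)| < d-1$. Then $|\mathcal{L}_{\lambda}(N)| < N-1$. In particular, if $|\mathcal{L}_{\lambda}(N)| = N-1$ then $|\mathcal{L}_{\lambda}(d)| = d-1$ for all $d \mid N$. Moreover, if $N \geq 2$ and $|\mathcal{L}_{\lambda}(N)| = N-1$, then $\mathcal{L}_{\lambda}(d) = \lambda(d-1)(d-1)$ and $\lambda(N-1) = \lambda(d-1)$ for all divisors $d \mid N$ with $d \geq 2$.
   Context: $\lambda$ is the Liouville function, $\lambda(n)=(-1)^{\Omega(n)}$ with $\Omega(n)$ the number of prime factors of $n$ counted with multiplicity. For an integer $N \geq 1$, $\mathcal{L}_{\lambda}(N) := \sum_{1 \leq n < N} \lambda(n)\lambda(N-n)$. -}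

module Defs where

open import Data.Nat using (ℕ; zero; suc; _+_; _∸_; _≤_; _<_)
open import Data.Nat.DivMod using (_/_; _%_)
open import Data.Integer using (ℤ; +_; -_; _*_) renaming (_+_ to _+ℤ_)
open import Data.List using (List; []; _∷_; foldr; map; applyUpTo; length)
open import Data.Bool using (Bool; true; false; if_then_else_)
open import Data.Nat using (_≡ᵇ_)

-- Prime factors of n (with multiplicity), listed by repeated trial division.
-- primeFactorsFrom fuel p n : divide n by candidate divisors p, p+1, ...
-- (the first candidate dividing n is necessarily prime).
primeFactorsFrom : ℕ → ℕ → ℕ → List ℕ
primeFactorsFrom zero p n = []
primeFactorsFrom (suc fuel) p zero = []
primeFactorsFrom (suc fuel) p (suc zero) = []
primeFactorsFrom (suc fuel) zero n = primeFactorsFrom fuel 2 n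
primeFactorsFrom (suc fuel) (suc zero) n = primeFactorsFrom fuel 2 n
primeFactorsFrom (suc fuel) p@(suc (suc k)) n@(suc (suc m)) =
  if (n % p) ≡ᵇ 0
    then p ∷ primeFactorsFrom fuel p (n / p)
    else primeFactorsFrom fuel (suc p) n

-- fuel 2n suffices: each step either divides n (at most log n times)
-- or increments the candidate p (at most n times).
primeFactors : ℕ → List ℕ
primeFactors n = primeFactorsFrom (n + n) 2 n

Ω : ℕ → ℕ
Ω n = length (primeFactors n)

negOnePow : ℕ → ℤ
negOnePow zero = + 1
negOnePow (suc k) = - negOnePow k

liouville : ℕ → ℤ
liouville n = negOnePow (Ω n)

sumℤ : List ℤ → ℤ
sumℤ = foldr _+ℤ_ (+ 0)

-- 𝓛_λ(N) = Σ_{1 ≤ n < N} λ(n) λ(N - n);  applyUpTo suc (N ∸ 1) = [1, ..., N-1]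
Lλ : ℕ → ℤ
Lλ N = sumℤ (map (λ n → liouville n * liouville (N ∸ n)) (applyUpTo suc (N ∸ 1)))

-- Write t_N(n) = λ(n) λ(N − n). Every term is ±1, so |𝓛_λ(N)| ≤ N − 1, with equality exactly
-- when all N − 1 terms are equal. Since λ is completely multiplicative and λ(q)² = 1, for N = q d
-- we have t_N(q k) = λ(q)² λ(k) λ(d − k) = t_d(k): the terms for d occur among those for N. Hence
-- if all terms for N equal a common sign c, so do all terms for d, giving 𝓛_λ(d) = c (d − 1);
-- and c = t_N(1) = λ(N − 1) while c = t_d(1) = λ(d − 1).
module Submission where

open import Defs
open import Data.Bool using (true; false; T)
open import Data.Integer as ℤ using (ℤ; +_; -_; ∣_∣; _*_; _⊖_; 1ℤ; -1ℤ) renaming (_+_ to _+ℤ_)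
import Data.Integer.Properties as ℤ
open import Algebra.Properties.CommutativeSemigroup ℤ.*-commutativeSemigroup using (interchange)
open import Data.List using (List; []; _∷_; _++_; map; applyUpTo; length)
open import Data.List.Properties using (length-++; length-map; length-applyUpTo)
open import Data.List.Membership.Propositional using (_∈_; find)
open import Data.List.Membership.Propositional.Properties
  using (∈-map⁺; ∈-applyUpTo⁺; ∈-applyUpTo⁻)
open import Data.List.Relation.Unary.All as All using (All; []; _∷_; all?)
open import Data.List.Relation.Unary.All.Properties using (++⁺; map⁺; ¬All⇒Any¬)
open import Data.List.Relation.Unary.Any using (here; there)
open import Data.List.Relation.Binary.Permutation.Propositional.Properties using (↭-length)
open import Data.Nat as ℕ using (ℕ; zero; suc; _+_; _∸_; _≤_; _<_; _≡ᵇ_; _%_; _/_; s≤s; z≤n; NonZero)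
import Data.Nat.Properties as ℕ
open import Data.Nat.Divisibility
  using (_∣_; divides; quotient≢0; quotient-∣; quotient-<; m∣n⇒n≡m*quotient; m%n≡0⇒n∣m; n∣m⇒m%n≡0)
open import Data.Nat.ListAction using (product)
open import Data.Nat.ListAction.Properties using (product-++)
open import Data.Nat.Primality using (Prime; _Rough_; 2-rough; rough⇒≤; ∤⇒rough-suc; rough∧∣⇒rough; rough∧∣⇒prime)
open import Data.Nat.Primality.Factorisation using (PrimeFactorisation; factorisationUnique)
open import Data.Product using (_×_; _,_; proj₁; proj₂; ∃-syntax; ∃₂; uncurry)
open import Data.Sum using (_⊎_; inj₁; inj₂)
open import Relation.Binary.PropositionalEquality
open import Relation.Nullary using (¬_; yes; no; contradiction)

private
  variable
    m n N d k : ℕ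
    x y c : ℤ
    zs : List ℤ

-- The fuel suffices because each step either replaces n by n / p < n or increments p, and it
-- cannot run out while n ≥ 2, since p Rough n forces p ≤ n.
primeFactorsFrom-correct : ∀ fuel p n .{{_ : NonZero n}} → 2 ≤ p → p Rough n → n < fuel + p →
  All Prime (primeFactorsFrom fuel p n) × product (primeFactorsFrom fuel p n) ≡ n
primeFactorsFrom-correct zero    p 1 _ _ _ = [] , refl
primeFactorsFrom-correct zero    p n@(suc (suc _)) _ rough n<p = contradiction (rough⇒≤ rough) (ℕ.<⇒≱ n<p)
primeFactorsFrom-correct (suc f) p 1 _ _ _ = [] , refl
primeFactorsFrom-correct (suc f) 0 (suc (suc _)) () _ _
primeFactorsFrom-correct (suc f) 1 (suc (suc _)) (s≤s ()) _ _
primeFactorsFrom-correct (suc f) p@(suc (suc _)) n@(suc (suc _)) p≥2 rough n<fuel+p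
  with n % p ≡ᵇ 0 in divisible
... | true = rough∧∣⇒prime rough p∣n ∷ proj₁ rest , trans (cong (p ℕ.*_) (proj₂ rest)) (sym (m∣n⇒n≡m*quotient p∣n))
  where
  p∣n : p ∣ n
  p∣n = m%n≡0⇒n∣m n p (ℕ.≡ᵇ⇒≡ (n % p) 0 (subst T (sym divisible) _))
  instance _ = quotient≢0 p∣n
  rest : All Prime (primeFactorsFrom f p (n / p)) × product (primeFactorsFrom f p (n / p)) ≡ n / p
  rest = primeFactorsFrom-correct f p (n / p) p≥2 (rough∧∣⇒rough rough (quotient-∣ p∣n))
           (ℕ.<-≤-trans (quotient-< p∣n) (ℕ.s≤s⁻¹ n<fuel+p))
... | false = primeFactorsFrom-correct f (suc p) n (ℕ.m≤n⇒m≤1+n p≥2) (∤⇒rough-suc p∤n rough)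
                (subst (n <_) (sym (ℕ.+-suc f p)) n<fuel+p)
  where
  p∤n : ¬ p ∣ n
  p∤n p∣n = subst T divisible (ℕ.≡⇒≡ᵇ (n % p) 0 (n∣m⇒m%n≡0 n p p∣n))

primeFactorisation : ∀ n .{{_ : NonZero n}} → PrimeFactorisation n
primeFactorisation n = record
  { factors         = primeFactors n
  ; isFactorisation = sym (proj₂ correct)
  ; factorsPrime    = proj₁ correct
  }
  where
  n<2n+2 : n < (n + n) + 2
  n<2n+2 = ℕ.<-≤-trans (ℕ.m<m+n n (s≤s z≤n)) (ℕ.+-monoˡ-≤ 2 (ℕ.m≤m+n n n))
  correct : All Prime (primeFactors n) × product (primeFactors n) ≡ n
  correct = primeFactorsFrom-correct (n + n) 2 n ℕ.≤-refl 2-rough n<2n+2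

factorisation-* : PrimeFactorisation m → PrimeFactorisation n → PrimeFactorisation (m ℕ.* n)
factorisation-* fm fn = record
  { factors         = factors fm ++ factors fn
  ; isFactorisation = trans (cong₂ ℕ._*_ (isFactorisation fm) (isFactorisation fn))
                            (sym (product-++ (factors fm) (factors fn)))
  ; factorsPrime    = ++⁺ (factorsPrime fm) (factorsPrime fn)
  }
  where open PrimeFactorisation

Ω-* : ∀ m n .{{_ : NonZero m}} .{{_ : NonZero n}} → Ω (m ℕ.* n) ≡ Ω m + Ω n
Ω-* m n = begin
  length (primeFactors (m ℕ.* n))
    ≡⟨ ↭-length (factorisationUnique (primeFactorisation (m ℕ.* n) {{ℕ.m*n≢0 m n}})
                                     (factorisation-* (primeFactorisation m) (primeFactorisation n))) ⟩
  length (primeFactors m ++ primeFactors n)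
    ≡⟨ length-++ (primeFactors m) ⟩
  Ω m + Ω n ∎
  where open ≡-Reasoning

IsSign : ℤ → Set
IsSign x = x ≡ 1ℤ ⊎ x ≡ -1ℤ

-‿sign : IsSign x → IsSign (- x)
-‿sign (inj₁ refl) = inj₂ refl
-‿sign (inj₂ refl) = inj₁ refl

*-sign : IsSign x → IsSign y → IsSign (x * y)
*-sign (inj₁ refl) (inj₁ refl) = inj₁ refl
*-sign (inj₁ refl) (inj₂ refl) = inj₂ refl
*-sign (inj₂ refl) (inj₁ refl) = inj₂ refl
*-sign (inj₂ refl) (inj₂ refl) = inj₁ refl

sign*sign≡1 : IsSign x → x * x ≡ 1ℤ
sign*sign≡1 (inj₁ refl) = refl
sign*sign≡1 (inj₂ refl) = refl

∣sign*n∣≡n : IsSign x → ∀ n → ∣ x * + n ∣ ≡ n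
∣sign*n∣≡n (inj₁ refl) n = cong ∣_∣ (ℤ.*-identityˡ (+ n))
∣sign*n∣≡n (inj₂ refl) n = trans (cong ∣_∣ (ℤ.-1*i≡-i (+ n))) (ℤ.∣-i∣≡∣i∣ (+ n))

negOnePow-sign : ∀ k → IsSign (negOnePow k)
negOnePow-sign zero    = inj₁ refl
negOnePow-sign (suc k) = -‿sign (negOnePow-sign k)

negOnePow-+ : ∀ m n → negOnePow (m + n) ≡ negOnePow m * negOnePow n
negOnePow-+ zero    n = sym (ℤ.*-identityˡ (negOnePow n))
negOnePow-+ (suc m) n = trans (cong -_ (negOnePow-+ m n)) (ℤ.neg-distribˡ-* (negOnePow m) (negOnePow n))

liouville-sign : ∀ n → IsSign (liouville n)
liouville-sign n = negOnePow-sign (Ω n)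

liouville-* : ∀ m n .{{_ : NonZero m}} .{{_ : NonZero n}} → liouville (m ℕ.* n) ≡ liouville m * liouville n
liouville-* m n = trans (cong negOnePow (Ω-* m n)) (negOnePow-+ (Ω m) (Ω n))

sumℤ-const : All (_≡ c) zs → sumℤ zs ≡ c * + length zs
sumℤ-const {c = c} []                 = sym (ℤ.*-zeroʳ c)
sumℤ-const {c = c} {zs = _ ∷ zs} (refl ∷ eqs) =
  trans (cong (c +ℤ_) (sumℤ-const eqs)) (sym (ℤ.*-suc c (+ length zs)))

signCounts : All IsSign zs → ∃₂ λ a b →
  sumℤ zs ≡ a ⊖ b × length zs ≡ a + b × (1ℤ ∈ zs → 1 ≤ a) × (-1ℤ ∈ zs → 1 ≤ b)
signCounts [] = 0 , 0 , refl , refl , (λ ()) , (λ ())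
signCounts (inj₁ refl ∷ signs) with a , b , sum≡ , length≡ , has+ , has- ← signCounts signs =
  suc a , b , trans (cong (1ℤ +ℤ_) sum≡) (ℤ.distribʳ-⊖-+-pos 1 a b) , cong suc length≡ ,
  (λ _ → s≤s z≤n) , λ { (here ()) ; (there -1∈) → has- -1∈ }
signCounts (inj₂ refl ∷ signs) with a , b , sum≡ , length≡ , has+ , has- ← signCounts signs =
  a , suc b , trans (cong (-1ℤ +ℤ_) sum≡) (ℤ.distribʳ-⊖-+-neg 0 a b) ,
  trans (cong suc length≡) (sym (ℕ.+-suc a b)) ,
  (λ { (here ()) ; (there 1∈) → has+ 1∈ }) , λ _ → s≤s z≤n

∣sumℤ∣<length : All IsSign zs → 1ℤ ∈ zs → -1ℤ ∈ zs → ∣ sumℤ zs ∣ < length zs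
∣sumℤ∣<length signs 1∈ -1∈ with a , b , sum≡ , length≡ , has+ , has- ← signCounts signs =
  subst₂ _<_ (cong ∣_∣ (sym sum≡)) (sym length≡) (ℕ.≤-<-trans (ℤ.∣m⊝n∣≤m⊔n a b) (ℕ.⊔-lub a<a+b b<a+b))
  where
  a<a+b : a < a + b
  a<a+b = ℕ.m<m+n a (has- -1∈)
  b<a+b : b < a + b
  b<a+b = ℕ.m<n+m b (has+ 1∈)

distinct⇒∣sumℤ∣<length : All IsSign zs → x ∈ zs → y ∈ zs → x ≢ y → ∣ sumℤ zs ∣ < length zs
distinct⇒∣sumℤ∣<length signs x∈ y∈ x≢y with All.lookup signs x∈ | All.lookup signs y∈
... | inj₁ refl | inj₁ refl = contradiction refl x≢y
... | inj₁ refl | inj₂ refl = ∣sumℤ∣<length signs x∈ y∈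
... | inj₂ refl | inj₁ refl = ∣sumℤ∣<length signs y∈ x∈
... | inj₂ refl | inj₂ refl = contradiction refl x≢y

term : ℕ → ℕ → ℤ
term N n = liouville n * liouville (N ∸ n)

term-sign : ∀ N n → IsSign (term N n)
term-sign N n = *-sign (liouville-sign n) (liouville-sign (N ∸ n))

term-1 : ∀ N → term N 1 ≡ liouville (N ∸ 1)
term-1 N = ℤ.*-identityˡ (liouville (N ∸ 1))

term-*ˡ : ∀ q .{{_ : NonZero q}} → 1 ≤ k → k < d → term (q ℕ.* d) (q ℕ.* k) ≡ term d k
term-*ˡ {k = k} {d = d} q 1≤k k<d = begin
  liouville (q ℕ.* k) * liouville (q ℕ.* d ∸ q ℕ.* k)
    ≡⟨ cong (λ m → liouville (q ℕ.* k) * liouville m) (sym (ℕ.*-distribˡ-∸ q d k)) ⟩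
  liouville (q ℕ.* k) * liouville (q ℕ.* (d ∸ k))
    ≡⟨ cong₂ _*_ (liouville-* q k) (liouville-* q (d ∸ k)) ⟩
  (λq * liouville k) * (λq * liouville (d ∸ k))
    ≡⟨ interchange λq (liouville k) λq (liouville (d ∸ k)) ⟩
  (λq * λq) * term d k
    ≡⟨ cong (_* term d k) (sign*sign≡1 (liouville-sign q)) ⟩
  1ℤ * term d k
    ≡⟨ ℤ.*-identityˡ (term d k) ⟩
  term d k ∎
  where
  open ≡-Reasoning
  λq = liouville q
  instance
    _ = ℕ.>-nonZero 1≤k
    _ = ℕ.>-nonZero (ℕ.m<n⇒0<n∸m k<d)

range : ℕ → List ℕ
range N = applyUpTo suc (N ∸ 1)

∈-range⁺ : 1 ≤ k → k < N → k ∈ range N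
∈-range⁺ {k = suc k} {N = suc N} _ (s≤s k<N) = ∈-applyUpTo⁺ suc k<N

∈-range⁻ : k ∈ range N → 1 ≤ k × k < N
∈-range⁻ {N = suc N} k∈ with i , i<N , refl ← ∈-applyUpTo⁻ suc k∈ = s≤s z≤n , s≤s i<N

terms : ℕ → List ℤ
terms N = map (term N) (range N)

length-terms : ∀ N → length (terms N) ≡ N ∸ 1
length-terms N = trans (length-map (term N) (range N)) (length-applyUpTo suc (N ∸ 1))

TermsEqual : ℕ → ℤ → Set
TermsEqual N c = ∀ {k} → 1 ≤ k → k < N → term N k ≡ c

termsEqual⇒Lλ≡ : TermsEqual N c → Lλ N ≡ c * + (N ∸ 1)
termsEqual⇒Lλ≡ {N = N} {c = c} equal = begin
  sumℤ (terms N)         ≡⟨ sumℤ-const (map⁺ (All.tabulate λ k∈ → uncurry equal (∈-range⁻ k∈))) ⟩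
  c * + length (terms N) ≡⟨ cong (λ n → c * + n) (length-terms N) ⟩
  c * + (N ∸ 1)          ∎
  where open ≡-Reasoning

termsEqual⇒∣Lλ∣≡ : IsSign c → TermsEqual N c → ∣ Lλ N ∣ ≡ N ∸ 1
termsEqual⇒∣Lλ∣≡ {N = N} sign equal = trans (cong ∣_∣ (termsEqual⇒Lλ≡ equal)) (∣sign*n∣≡n sign (N ∸ 1))

distinctTerms⇒∣Lλ∣< : ∀ {j} → 1 ≤ j → j < N → 1 ≤ k → k < N → term N j ≢ term N k → ∣ Lλ N ∣ < N ∸ 1
distinctTerms⇒∣Lλ∣< {N = N} 1≤j j<N 1≤k k<N distinct =
  subst (∣ Lλ N ∣ <_) (length-terms N)
    (distinct⇒∣sumℤ∣<length (map⁺ (All.tabulate λ {n} _ → term-sign N n))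
      (∈-map⁺ (term N) (∈-range⁺ 1≤j j<N)) (∈-map⁺ (term N) (∈-range⁺ 1≤k k<N)) distinct)

termsEqual⊎∣Lλ∣< : ∀ N → TermsEqual N (term N 1) ⊎ ∣ Lλ N ∣ < N ∸ 1
termsEqual⊎∣Lλ∣< N with all? (λ k → term N k ℤ.≟ term N 1) (range N)
... | yes equal = inj₁ λ 1≤k k<N → All.lookup equal (∈-range⁺ 1≤k k<N)
... | no ¬equal with k , k∈ , distinct ← find (¬All⇒Any¬ (λ k → term N k ℤ.≟ term N 1) (range N) ¬equal) =
  let 1≤k , k<N = ∈-range⁻ k∈ in
  inj₂ (distinctTerms⇒∣Lλ∣< 1≤k k<N ℕ.≤-refl (ℕ.≤-<-trans 1≤k k<N) distinct)

∣Lλ∣≡⇒termsEqual : ∣ Lλ N ∣ ≡ N ∸ 1 → TermsEqual N (term N 1)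
∣Lλ∣≡⇒termsEqual {N = N} ∣Lλ∣≡ with termsEqual⊎∣Lλ∣< N
... | inj₁ equal = equal
... | inj₂ ∣Lλ∣< = contradiction ∣Lλ∣≡ (ℕ.<⇒≢ ∣Lλ∣<)

termsEqual-∣ : 1 ≤ N → d ∣ N → TermsEqual N c → TermsEqual d c
termsEqual-∣ N≥1 (divides q refl) equal {k} 1≤k k<d =
  trans (sym (term-*ˡ q 1≤k k<d)) (equal (ℕ.>-nonZero⁻¹ (q ℕ.* k) {{ℕ.m*n≢0 q k}}) (ℕ.*-monoʳ-< q k<d))
  where
  instance
    _ = ℕ.m*n≢0⇒m≢0 q {{ℕ.>-nonZero N≥1}}
    _ = ℕ.>-nonZero 1≤k

lemma2p1 : (N : ℕ) → 1 ≤ N →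
    ((∃[ d ] (d ∣ N × ∣ Lλ d ∣ < d ∸ 1)) → ∣ Lλ N ∣ < N ∸ 1)
    × (∣ Lλ N ∣ ≡ N ∸ 1 → (d : ℕ) → d ∣ N → ∣ Lλ d ∣ ≡ d ∸ 1)
    × (2 ≤ N → ∣ Lλ N ∣ ≡ N ∸ 1 → (d : ℕ) → d ∣ N → 2 ≤ d →
        (Lλ d ≡ liouville (d ∸ 1) * + (d ∸ 1)) × (liouville (N ∸ 1) ≡ liouville (d ∸ 1)))
lemma2p1 N N≥1 = strict , extremal , extremal-values
  where
  extremal : ∣ Lλ N ∣ ≡ N ∸ 1 → (d : ℕ) → d ∣ N → ∣ Lλ d ∣ ≡ d ∸ 1
  extremal ∣Lλ∣≡ d d∣N = termsEqual⇒∣Lλ∣≡ (term-sign N 1) (termsEqual-∣ N≥1 d∣N (∣Lλ∣≡⇒termsEqual ∣Lλ∣≡))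

  strict : ∃[ d ] (d ∣ N × ∣ Lλ d ∣ < d ∸ 1) → ∣ Lλ N ∣ < N ∸ 1
  strict (d , d∣N , ∣Lλd∣<) with termsEqual⊎∣Lλ∣< N
  ... | inj₁ equal = contradiction (termsEqual⇒∣Lλ∣≡ (term-sign N 1) (termsEqual-∣ N≥1 d∣N equal)) (ℕ.<⇒≢ ∣Lλd∣<)
  ... | inj₂ ∣Lλ∣< = ∣Lλ∣<

  extremal-values : 2 ≤ N → ∣ Lλ N ∣ ≡ N ∸ 1 → (d : ℕ) → d ∣ N → 2 ≤ d →
    (Lλ d ≡ liouville (d ∸ 1) * + (d ∸ 1)) × (liouville (N ∸ 1) ≡ liouville (d ∸ 1))
  extremal-values _ ∣Lλ∣≡ d d∣N d≥2 =
    subst (λ c → Lλ d ≡ c * + (d ∸ 1)) c≡λ[d-1] (termsEqual⇒Lλ≡ equal) , trans (sym (term-1 N)) c≡λ[d-1]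
    where
    equal : TermsEqual d (term N 1)
    equal = termsEqual-∣ N≥1 d∣N (∣Lλ∣≡⇒termsEqual ∣Lλ∣≡)
    c≡λ[d-1] : term N 1 ≡ liouville (d ∸ 1)
    c≡λ[d-1] = trans (sym (equal ℕ.≤-refl d≥2)) (term-1 d)
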